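{- Let $T\in\mathbb{F}^{n_1}\otimes\mathbb{F}^{n_2}\otimes\mathbb{F}^{n_3}$ be concise. For every choice of distinct $i,j,k\in[3]$ we have $\rho_{i,j}(T)\cdot\max\{Q_i(T),Q_j(T)\}\geq n_k$.
   Context: For a nonzero matrix $A\in\mathbb{F}^{m_1\times m_2}$, its pivot $p(A)$ is the lexicographically smallest $(a,b)$ with $A_{a,b}\neq 0$. Every subspace $\mathcal{A}$ of $m_1\times m_2$ matrices has a basis whose elements have pairwise distinct pivots, and the set of these pivots is the same for every such basis; it is denoted $p(\mathcal{A})$. $\rho(\mathcal{A})$ is the smallest $|S_1|+|S_2|$ over $S_1\subseteq[m_1]$, $S_2\subseteq[m_2]$ with $p(\mathcal{A})\subseteq(S_1\times[m_2])\cup([m_1]\times S_2)$. For $T=\sum T_{a_1,a_2,a_3}e_{a_1}\otimes e_{a_2}\otimes e_{a_3}$ and distinct $i,j\in[3]$ with $\ell$ the third index, $\mathcal{A}_{i,j}\subseteq\mathbb{F}^{n_i}\otimes\mathbb{F}^{n_j}$ is the span, over $t\in[n_\ell]$, of the matrices whose $(a,b)$ entry ($a\in[n_i]$ indexing rows, $b\in[n_j]$ indexing columns) is the coefficient of $T$ with $a_i=a$, $a_j=b$, $a_\ell=t$; and $\rho_{i,j}(T)=\rho(\mathcal{A}_{i,j})$. For $\ell\in[3]$, $Q_\ell(T)$ is the maximum rank of an element of the span of the $\ell$-slices of $T$ (the matrices obtained by fixing the $\ell$-th index). $T$ is concise if each flattening $\mathbb{F}^{n_i}\otimes(\mathbb{F}^{n_j}\otimes\mathbb{F}^{n_k})$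 has rank $n_i$. -}

module Defs where

open import Level using (Level; _⊔_)
open import Algebra.Bundles using (CommutativeRing)
open import Data.Nat as ℕ using (ℕ; zero; suc)
open import Data.Fin as Fin using (Fin; zero; suc)
open import Data.Fin.Subset using (Subset; _∈_; ∣_∣)
open import Data.Product using (Σ; ∃; ∃-syntax; _×_; _,_)
open import Data.Sum using (_⊎_)
open import Relation.Nullary using (¬_)
open import Relation.Binary.PropositionalEquality using (_≡_)

record Field (c ℓ : Level) : Set (Level.suc (c ⊔ ℓ)) where
  field
    commRing : CommutativeRing c ℓ
  open CommutativeRing commRing public
  field
    1≉0 : ¬ (1# ≈ 0#)
    inverse : ∀ x → ¬ (x ≈ 0#) → ∃[ y ] (x * y ≈ 1#)

module FieldDefs {c ℓ : Level} (F : Field c ℓ) where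
  open Field F using (Carrier; _≈_; _+_; _*_; 0#; 1#)

  sumF : ∀ {n} → (Fin n → Carrier) → Carrier
  sumF {zero} f = 0#
  sumF {suc n} f = f zero + sumF (λ t → f (suc t))

  Mat : ℕ → Set → Set c
  Mat m J = Fin m → J → Carrier

  LinIndepCols : ∀ {m J r} → Mat m J → (Fin r → J) → Set (c ⊔ ℓ)
  LinIndepCols {m} {J} {r} M σ =
    (coef : Fin r → Carrier) →
    (∀ a → sumF (λ s → coef s * M a (σ s)) ≈ 0#) →
    ∀ s → coef s ≈ 0#

  RankGE : ∀ {m J} → Mat m J → ℕ → Set (c ⊔ ℓ)
  RankGE {m} {J} M r = Σ (Fin r → J) (LinIndepCols M)

  HasRank : ∀ {m J} → Mat m J → ℕ → Set (c ⊔ ℓ)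
  HasRank M r = RankGE M r × ¬ RankGE M (suc r)

  InSpan : ∀ {d m n} → (Fin d → Mat m (Fin n)) → Mat m (Fin n) → Set (c ⊔ ℓ)
  InSpan {d} gens A = Σ (Fin d → Carrier) λ coef → (∀ a b → A a b ≈ sumF {d} (λ t → coef t * gens t a b))

  LinIndepFam : ∀ {e m n} → (Fin e → Mat m (Fin n)) → Set (c ⊔ ℓ)
  LinIndepFam {e} B =
    (coef : Fin e → Carrier) →
    (∀ a b → sumF (λ s → coef s * B s a b) ≈ 0#) →
    ∀ s → coef s ≈ 0#

  IsBasisOfSpan : ∀ {d e m n} → (Fin d → Mat m (Fin n)) → (Fin e → Mat m (Fin n)) → Set (c ⊔ ℓ)
  IsBasisOfSpan gens B =
    (∀ s → InSpan gens (B s)) × LinIndepFam B × (∀ t → InSpan B (gens t))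

  _<lex_ : ∀ {m n} → Fin m × Fin n → Fin m × Fin n → Set
  (a' , b') <lex (a , b) = (a' Fin.< a) ⊎ (a' ≡ a × b' Fin.< b)

  IsPivot : ∀ {m n} → Mat m (Fin n) → Fin m × Fin n → Set ℓ
  IsPivot A (a , b) = ¬ (A a b ≈ 0#) × (∀ a' b' → (a' , b') <lex (a , b) → A a' b' ≈ 0#)

  DistinctPivots : ∀ {e m n} → (Fin e → Mat m (Fin n)) → Set ℓ
  DistinctPivots B = ∀ s s' p → IsPivot (B s) p → IsPivot (B s') p → s ≡ s'

  -- p ∈ p(span gens): p is the pivot of an element of a basis of span gens
  -- with pairwise distinct pivots (the set is independent of the basis)
  InPivotSet : ∀ {d m n} → (Fin d → Mat m (Fin n)) → Fin m × Fin n → Set (c ⊔ ℓ)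
  InPivotSet {d} {m} {n} gens p =
    ∃[ e ] Σ (Fin e → Mat m (Fin n)) λ B →
      IsBasisOfSpan gens B × DistinctPivots B × ∃[ s ] IsPivot (B s) p

  Covers : ∀ {d m n} → (Fin d → Mat m (Fin n)) → Subset m → Subset n → Set (c ⊔ ℓ)
  Covers gens S₁ S₂ = ∀ a b → InPivotSet gens (a , b) → (a ∈ S₁) ⊎ (b ∈ S₂)

  IsRhoSpan : ∀ {d m n} → (Fin d → Mat m (Fin n)) → ℕ → Set (c ⊔ ℓ)
  IsRhoSpan {d} {m} {n} gens r =
    (∃[ S₁ ] ∃[ S₂ ] (Covers gens S₁ S₂ × ∣ S₁ ∣ ℕ.+ ∣ S₂ ∣ ≡ r)) ×
    (∀ S₁ S₂ → Covers gens S₁ S₂ → r ℕ.≤ ∣ S₁ ∣ ℕ.+ ∣ S₂ ∣)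

  IsMaxRankSpan : ∀ {d m n} → (Fin d → Mat m (Fin n)) → ℕ → Set (c ⊔ ℓ)
  IsMaxRankSpan {d} {m} {n} gens q =
    (∃[ A ] (InSpan gens A × HasRank A q)) ×
    (∀ A → InSpan gens A → ¬ RankGE A (suc q))

  module TensorDefs {n₁ n₂ n₃ : ℕ} (T : Fin n₁ → Fin n₂ → Fin n₃ → Carrier) where

    dim : Fin 3 → ℕ
    dim zero = n₁
    dim (suc zero) = n₂
    dim (suc (suc zero)) = n₃

    Concise : Set (c ⊔ ℓ)
    Concise =
      HasRank {n₁} {Fin n₂ × Fin n₃} (λ a (b , c) → T a b c) n₁ ×
      HasRank {n₂} {Fin n₁ × Fin n₃} (λ b (a , c) → T a b c) n₂ ×
      HasRank {n₃} {Fin n₁ × Fin n₂} (λ c (a , b) → T a b c) n₃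

    -- gen i j l t : the matrix (a , b) ↦ coefficient of T with a_i = a,
    -- a_j = b, a_l = t  (only meaningful for i, j, l pairwise distinct)
    gen : (i j l : Fin 3) → Fin (dim l) → Mat (dim i) (Fin (dim j))
    gen zero (suc zero) (suc (suc zero)) t a b = T a b t
    gen (suc zero) zero (suc (suc zero)) t a b = T b a t
    gen zero (suc (suc zero)) (suc zero) t a b = T a t b
    gen (suc (suc zero)) zero (suc zero) t a b = T b t a
    gen (suc zero) (suc (suc zero)) zero t a b = T t a b
    gen (suc (suc zero)) (suc zero) zero t a b = T t b a
    gen _ _ _ t a b = 0#

    IsRho : (i j l : Fin 3) → ℕ → Set (c ⊔ ℓ)
    IsRho i j l r = IsRhoSpan (gen i j l) r

    IsQ : (l : Fin 3) → ℕ → Set (c ⊔ ℓ)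
    IsQ zero q = IsMaxRankSpan {n₁} {n₂} {n₃} (λ t b c → T t b c) q
    IsQ (suc zero) q = IsMaxRankSpan {n₂} {n₁} {n₃} (λ t a c → T a t c) q
    IsQ (suc (suc zero)) q = IsMaxRankSpan {n₃} {n₁} {n₂} (λ t a b → T a b t) q

-- The k-slices G_t (t < n_k) of T, read as n_i × n_j matrices, are linearly independent by
-- conciseness, so an echelon basis of their span (pivots ordered lexicographically) has n_k
-- elements. Fix rows S₁ and columns S₂ covering its pivots with |S₁| + |S₂| = ρ_{i,j}(T). A linear
-- combination of the basis matrices that vanishes on these lines vanishes at every pivot, hence is
-- trivial. Row a of every matrix in the span lies in the span of the lines of the i-slice of T at a,
-- a space of dimension at most Q_i, and likewise every column lies in a space of dimension at most
-- Q_j. Hence n_k ≤ |S₁| Q_i + |S₂| Q_j ≤ ρ_{i,j}(T) · max(Q_i, Q_j).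
--
-- Equality in the field need not be decidable, so elimination and dimension arguments run in the
-- double-negation monad; the conclusion, an inequality of natural numbers, is stable.

module Submission where

open import Defs
open import Level using (Level) renaming (_⊔_ to _⊔ˡ_)
open import Data.Nat as ℕ using (ℕ; zero; suc; s≤s)
import Data.Nat.Properties as ℕ
open import Data.Fin as Fin using (Fin; zero; suc; punchIn)
open import Data.Fin.Patterns using (0F; 1F; 2F)
import Data.Fin.Properties as Fin
import Data.Fin.Induction as Fin
open import Data.Vec.Functional using (_∷_; insertAt)
open import Data.Vec.Base as Vec using (here; there)
open import Data.Fin.Subset using (Subset; _∈_; ∣_∣; inside; outside)
open import Data.Vec.Functional.Properties using (insertAt-lookup; insertAt-punchIn)
open import Data.Product using (Σ; ∃; _×_; _,_; proj₁; proj₂; uncurry; swap; map; map₂)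
open import Data.Sum using (_⊎_; inj₁; inj₂; [_,_]′)
open import Function using (_∘_; _↔_; Inverse; case_of_)
open import Function.Construct.Composition using (_↔-∘_)
open import Data.Sum.Function.Propositional using (_⊎-↔_)
open import Relation.Nullary using (¬_; Dec; yes; no; contradiction)
open import Relation.Nullary.Decidable using (¬¬-excluded-middle; ¬?; decidable-stable)
open import Relation.Binary.PropositionalEquality as ≡ using (_≡_; _≢_)
open import Relation.Binary.Definitions using (tri<; tri≈; tri>)
open import Induction.WellFounded using (Acc; acc)

infixl 1 _>>=_

_>>=_ : ∀ {a b} {A : Set a} {B : Set b} → ¬ ¬ A → (A → ¬ ¬ B) → ¬ ¬ B
(¬¬a >>= f) ¬b = ¬¬a (λ a → f a ¬b)

return : ∀ {a} {A : Set a} → A → ¬ ¬ A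
return a ¬a = ¬a a

¬¬-∀-Fin : ∀ {p n} {P : Fin n → Set p} → (∀ i → ¬ ¬ P i) → ¬ ¬ (∀ i → P i)
¬¬-∀-Fin {n = zero} _ = return (λ ())
¬¬-∀-Fin {n = suc n} ¬¬P = do
  P₀ ← ¬¬P zero
  Pₛ ← ¬¬-∀-Fin (¬¬P ∘ suc)
  return λ { zero → P₀ ; (suc i) → Pₛ i }

enumerate : ∀ {n} (S : Subset n) → Fin ∣ S ∣ → Fin n
enumerate (inside Vec.∷ S) zero = zero
enumerate (inside Vec.∷ S) (suc i) = suc (enumerate S i)
enumerate (outside Vec.∷ S) i = suc (enumerate S i)

enumerate-onto : ∀ {n} (S : Subset n) {a} → a ∈ S → ∃ λ i → enumerate S i ≡ a
enumerate-onto (inside Vec.∷ S) here = zero , ≡.refl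
enumerate-onto (inside Vec.∷ S) (there a∈S) = map suc (≡.cong suc) (enumerate-onto S a∈S)
enumerate-onto (outside Vec.∷ S) (there a∈S) = map₂ (≡.cong suc) (enumerate-onto S a∈S)

weighted-sum-≤ : ∀ {x y r qi qj} → x ℕ.+ y ≡ r → x ℕ.* qi ℕ.+ y ℕ.* qj ℕ.≤ r ℕ.* (qi ℕ.⊔ qj)
weighted-sum-≤ {x} {y} {r} {qi} {qj} x+y≡r = begin
  x ℕ.* qi ℕ.+ y ℕ.* qj  ≤⟨ ℕ.+-mono-≤ (ℕ.*-monoʳ-≤ x (ℕ.m≤m⊔n qi qj)) (ℕ.*-monoʳ-≤ y (ℕ.m≤n⊔m qi qj)) ⟩
  x ℕ.* Q ℕ.+ y ℕ.* Q    ≡⟨ ℕ.*-distribʳ-+ Q x y ⟨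
  (x ℕ.+ y) ℕ.* Q        ≡⟨ ≡.cong (ℕ._* Q) x+y≡r ⟩
  r ℕ.* Q                ∎
  where
  open ℕ.≤-Reasoning
  Q = qi ℕ.⊔ qj

module _ {c ℓ : Level} (F : Field c ℓ) where
  open Field F hiding (zero)
  open FieldDefs F
  open import Algebra.Properties.Semiring.Sum semiring
  open import Algebra.Properties.Ring ring using (-1*x≈-x; -‿distribˡ-*)
  open import Relation.Binary.Reasoning.Setoid setoid

  K : Set c
  K = Carrier

  x*y≈0⇒x≈0 : ∀ {x y} → x * y ≈ 0# → ¬ y ≈ 0# → x ≈ 0#
  x*y≈0⇒x≈0 {x} {y} xy≈0 y≉0 with inverse y y≉0
  ... | y⁻¹ , yy⁻¹≈1 = begin
    x              ≈⟨ *-identityʳ x ⟨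
    x * 1#         ≈⟨ *-congˡ yy⁻¹≈1 ⟨
    x * (y * y⁻¹)  ≈⟨ *-assoc x y y⁻¹ ⟨
    x * y * y⁻¹    ≈⟨ *-congʳ xy≈0 ⟩
    0# * y⁻¹       ≈⟨ zeroˡ y⁻¹ ⟩
    0#             ∎

  x+-[x*y]*z≈0 : ∀ x {y z} → z * y ≈ 1# → x + - (x * y) * z ≈ 0#
  x+-[x*y]*z≈0 x {y} {z} zy≈1 = begin
    x + - (x * y) * z  ≈⟨ +-congˡ (-‿distribˡ-* (x * y) z) ⟨
    x + - (x * y * z)  ≈⟨ +-congˡ (-‿cong xyz≈x) ⟩
    x + - x            ≈⟨ -‿inverseʳ x ⟩
    0#                 ∎
    where
    xyz≈x : x * y * z ≈ x
    xyz≈x = trans (*-assoc x y z) (trans (*-congˡ (trans (*-comm y z) zy≈1)) (*-identityʳ x))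

  sumF≈sum : ∀ {n} (f : Fin n → K) → sumF f ≈ sum f
  sumF≈sum {zero} f = refl
  sumF≈sum {suc n} f = +-congˡ (sumF≈sum (f ∘ suc))

  sum-zero : ∀ {n} {f : Fin n → K} → (∀ i → f i ≈ 0#) → sum f ≈ 0#
  sum-zero {n} f≈0 = trans (sum-cong-≋ f≈0) (sum-replicate-zero n)

  sum-single : ∀ {n} (f : Fin n → K) i → (∀ j → j ≢ i → f j ≈ 0#) → sum f ≈ f i
  sum-single {suc n} f i f≈0 = begin
    sum f                       ≈⟨ sum-remove f ⟩
    f i + sum (f ∘ punchIn i)   ≈⟨ +-congˡ (sum-zero (λ j → f≈0 _ (Fin.punchInᵢ≢i i j))) ⟩
    f i + 0#                    ≈⟨ +-identityʳ (f i) ⟩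
    f i                         ∎

  -- Spans and linear independence

  δ : ∀ {n} → Fin n → Fin n → K
  δ i k with i Fin.≟ k
  ... | yes _ = 1#
  ... | no _ = 0#

  δ-refl : ∀ {n} (i : Fin n) → δ i i ≈ 1#
  δ-refl i with i Fin.≟ i
  ... | yes _ = refl
  ... | no i≢i = contradiction ≡.refl i≢i

  δ-≢ : ∀ {n} {i k : Fin n} → i ≢ k → δ i k ≈ 0#
  δ-≢ {i = i} {k} i≢k with i Fin.≟ k
  ... | yes i≡k = contradiction i≡k i≢k
  ... | no _ = refl

  ∑-δ : ∀ {n} (f : Fin n → K) i → ∑[ k < n ] (f k * δ k i) ≈ f i
  ∑-δ f i = begin
    ∑[ k < _ ] (f k * δ k i)  ≈⟨ sum-single _ i (λ k k≢i → trans (*-congˡ (δ-≢ k≢i)) (zeroʳ (f k))) ⟩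
    f i * δ i i               ≈⟨ *-congˡ (δ-refl i) ⟩
    f i * 1#                  ≈⟨ *-identityʳ (f i) ⟩
    f i                       ∎

  infix 4 _∈⟨_⟩ _⊆⟨_⟩

  record _∈⟨_⟩ {J : Set} {e} (v : J → K) (w : Fin e → J → K) : Set (c ⊔ˡ ℓ) where
    constructor span
    field
      coeff : Fin e → K
      expand : ∀ j → v j ≈ ∑[ i < e ] (coeff i * w i j)
  open _∈⟨_⟩

  _⊆⟨_⟩ : ∀ {J : Set} {n e} → (Fin n → J → K) → (Fin e → J → K) → Set (c ⊔ˡ ℓ)
  u ⊆⟨ w ⟩ = ∀ s → u s ∈⟨ w ⟩

  Independent : ∀ {J : Set} {n} → (Fin n → J → K) → Set (c ⊔ˡ ℓ)
  Independent {n = n} u = (a : Fin n → K) → (∀ j → ∑[ s < n ] (a s * u s j) ≈ 0#) → ∀ s → a s ≈ 0#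

  module _ {J : Set} where

    ∈⟨⟩-cong : ∀ {e} {w : Fin e → J → K} {v v′ : J → K} → (∀ j → v j ≈ v′ j) → v ∈⟨ w ⟩ → v′ ∈⟨ w ⟩
    ∈⟨⟩-cong v≈v′ (span a v≈) = span a λ j → trans (sym (v≈v′ j)) (v≈ j)

    ∈⟨⟩-0 : ∀ {e} {w : Fin e → J → K} → (λ _ → 0#) ∈⟨ w ⟩
    ∈⟨⟩-0 {w = w} = span (λ _ → 0#) λ j → sym (sum-zero (λ i → zeroˡ (w i j)))

    ∈⟨⟩-+ : ∀ {e} {w : Fin e → J → K} {v v′ : J → K} → v ∈⟨ w ⟩ → v′ ∈⟨ w ⟩ → (λ j → v j + v′ j) ∈⟨ w ⟩
    ∈⟨⟩-+ {e} {w} {v} {v′} (span a v≈) (span b v′≈) = span (λ i → a i + b i) λ j → begin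
      v j + v′ j                                          ≈⟨ +-cong (v≈ j) (v′≈ j) ⟩
      ∑[ i < e ] (a i * w i j) + ∑[ i < e ] (b i * w i j)  ≈⟨ ∑-distrib-+ (λ i → a i * w i j) (λ i → b i * w i j) ⟨
      ∑[ i < e ] (a i * w i j + b i * w i j)              ≈⟨ sum-cong-≋ (λ i → distribʳ (w i j) (a i) (b i)) ⟨
      ∑[ i < e ] ((a i + b i) * w i j)                    ∎

    ∈⟨⟩-* : ∀ {e} {w : Fin e → J → K} {v : J → K} x → v ∈⟨ w ⟩ → (λ j → x * v j) ∈⟨ w ⟩
    ∈⟨⟩-* {e} {w} {v} x (span a v≈) = span (λ i → x * a i) λ j → begin
      x * v j                       ≈⟨ *-congˡ (v≈ j) ⟩
      x * ∑[ i < e ] (a i * w i j)  ≈⟨ *-distribˡ-sum x (λ i → a i * w i j) ⟩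
      ∑[ i < e ] (x * (a i * w i j)) ≈⟨ sum-cong-≋ (λ i → *-assoc x (a i) (w i j)) ⟨
      ∑[ i < e ] (x * a i * w i j)  ∎

    ∈⟨⟩-member : ∀ {e} (w : Fin e → J → K) i → w i ∈⟨ w ⟩
    ∈⟨⟩-member w i = span (λ k → δ k i) λ j →
      sym (trans (sum-cong-≋ (λ k → *-comm (δ k i) (w k j))) (∑-δ (λ k → w k j) i))

    ∑-reassociate : ∀ {m e} (b : Fin m → K) (a : Fin m → Fin e → K) (w : Fin e → J → K) j →
      ∑[ s < m ] (b s * ∑[ i < e ] (a s i * w i j)) ≈ ∑[ i < e ] (∑[ s < m ] (b s * a s i) * w i j)
    ∑-reassociate {m} {e} b a w j = begin
      ∑[ s < m ] (b s * ∑[ i < e ] (a s i * w i j))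
        ≈⟨ sum-cong-≋ (λ s → *-distribˡ-sum (b s) (λ i → a s i * w i j)) ⟩
      ∑[ s < m ] ∑[ i < e ] (b s * (a s i * w i j))
        ≈⟨ ∑-comm (λ s i → b s * (a s i * w i j)) ⟩
      ∑[ i < e ] ∑[ s < m ] (b s * (a s i * w i j))
        ≈⟨ sum-cong-≋ (λ i → sum-cong-≋ (λ s → *-assoc (b s) (a s i) (w i j))) ⟨
      ∑[ i < e ] ∑[ s < m ] (b s * a s i * w i j)
        ≈⟨ sum-cong-≋ (λ i → *-distribʳ-sum (w i j) (λ s → b s * a s i)) ⟨
      ∑[ i < e ] (∑[ s < m ] (b s * a s i) * w i j)
        ∎

    ∈⟨⟩-∑ : ∀ {m e} {u : Fin m → J → K} {w : Fin e → J → K} (b : Fin m → K) →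
      u ⊆⟨ w ⟩ → (λ j → ∑[ s < m ] (b s * u s j)) ∈⟨ w ⟩
    ∈⟨⟩-∑ {w = w} b u⊆w = span (λ i → ∑[ s < _ ] (b s * coeff (u⊆w s) i)) λ j →
      trans (sum-cong-≋ (λ s → *-congˡ (expand (u⊆w s) j))) (∑-reassociate b (coeff ∘ u⊆w) w j)

    ∈⟨⟩-trans : ∀ {m e} {v : J → K} {u : Fin m → J → K} {w : Fin e → J → K} →
      v ∈⟨ u ⟩ → u ⊆⟨ w ⟩ → v ∈⟨ w ⟩
    ∈⟨⟩-trans (span b v≈) u⊆w = ∈⟨⟩-cong (λ j → sym (v≈ j)) (∈⟨⟩-∑ b u⊆w)

    ∈⟨⟩-∘ : ∀ {m e} {v : J → K} {w : Fin e → J → K} (σ : Fin m → Fin e) → v ∈⟨ w ∘ σ ⟩ → v ∈⟨ w ⟩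
    ∈⟨⟩-∘ {w = w} σ v∈ = ∈⟨⟩-trans v∈ (∈⟨⟩-member w ∘ σ)

    ∈⟨⟩-∷ : ∀ {e} {w : Fin (suc e) → J → K} {v : J → K} b → v ∈⟨ w ∘ suc ⟩ →
      (λ j → b * w zero j + v j) ∈⟨ w ⟩
    ∈⟨⟩-∷ b (span a v≈) = span (b ∷ a) λ j → +-congˡ (v≈ j)

    ∈⟨⟩-weaken : ∀ {e} {w : Fin (suc e) → J → K} {v : J → K} → v ∈⟨ w ∘ suc ⟩ → v ∈⟨ w ⟩
    ∈⟨⟩-weaken {w = w} v∈ =
      ∈⟨⟩-cong {w = w} (λ j → trans (+-congʳ (zeroˡ (w zero j))) (+-identityˡ _)) (∈⟨⟩-∷ 0# v∈)

    ∈⟨⟩-tail : ∀ {e} {w : Fin (suc e) → J → K} {v : J → K} (v∈ : v ∈⟨ w ⟩) →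
      coeff v∈ zero ≈ 0# → v ∈⟨ w ∘ suc ⟩
    ∈⟨⟩-tail {w = w} (span a v≈) a₀≈0 = span (a ∘ suc) λ j →
      trans (v≈ j) (trans (+-congʳ (trans (*-congʳ a₀≈0) (zeroˡ (w zero j)))) (+-identityˡ _))

    relation-from-coordinates : ∀ {n e} {u : Fin n → J → K} {w : Fin e → J → K} (u⊆w : u ⊆⟨ w ⟩)
      (a : Fin n → K) → (∀ i → ∑[ s < n ] (a s * coeff (u⊆w s) i) ≈ 0#) →
      ∀ j → ∑[ s < n ] (a s * u s j) ≈ 0#
    relation-from-coordinates {n} {e} {u} {w} u⊆w a rel j = begin
      ∑[ s < n ] (a s * u s j)
        ≈⟨ sum-cong-≋ (λ s → *-congˡ (expand (u⊆w s) j)) ⟩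
      ∑[ s < n ] (a s * ∑[ i < e ] (coeff (u⊆w s) i * w i j))
        ≈⟨ ∑-reassociate a (coeff ∘ u⊆w) w j ⟩
      ∑[ i < e ] (∑[ s < n ] (a s * coeff (u⊆w s) i) * w i j)
        ≈⟨ sum-zero (λ i → trans (*-congʳ (rel i)) (zeroˡ (w i j))) ⟩
      0#
        ∎

  ∈⟨⟩-reindex : ∀ {J J′ : Set} {e} {v : J → K} {w : Fin e → J → K} (f : J′ → J) →
    v ∈⟨ w ⟩ → (v ∘ f) ∈⟨ (λ i → w i ∘ f) ⟩
  ∈⟨⟩-reindex f (span a v≈) = span a (v≈ ∘ f)

  -- Steinitz exchange

  exchange : ∀ {J : Set} {n e} {u : Fin (suc n) → J → K} {w : Fin (suc e) → J → K} →
    Independent u → (u⊆w : u ⊆⟨ w ⟩) → ∀ s₀ → ¬ coeff (u⊆w s₀) zero ≈ 0# →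
    Σ (Fin n → J → K) λ u′ → Independent u′ × u′ ⊆⟨ w ∘ suc ⟩
  exchange {J} {n} {u = u} {w} u-indep u⊆w s₀ a₀≉0 = u′ , u′-indep , u′⊆w
    where
    y : K
    y = proj₁ (inverse _ a₀≉0)

    μ : Fin n → K
    μ k = - (coeff (u⊆w (punchIn s₀ k)) zero * y)

    -- μ k cancels the coefficient of w zero in u′ k.
    u′ : Fin n → J → K
    u′ k j = u (punchIn s₀ k) j + μ k * u s₀ j

    u′⊆w : u′ ⊆⟨ w ∘ suc ⟩
    u′⊆w k = ∈⟨⟩-tail {w = w} (∈⟨⟩-+ (u⊆w (punchIn s₀ k)) (∈⟨⟩-* (μ k) (u⊆w s₀)))
                      (x+-[x*y]*z≈0 (coeff (u⊆w (punchIn s₀ k)) zero) (proj₂ (inverse _ a₀≉0)))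

    u′-indep : Independent u′
    u′-indep β β-rel k = trans (reflexive (≡.sym (insertAt-punchIn β s₀ βμ k))) (u-indep γ γ-rel (punchIn s₀ k))
      where
      βμ : K
      βμ = ∑[ k < n ] (β k * μ k)
      γ : Fin (suc n) → K
      γ = insertAt β s₀ βμ
      γ-rel : ∀ j → ∑[ s < suc n ] (γ s * u s j) ≈ 0#
      γ-rel j = begin
        ∑[ s < suc n ] (γ s * u s j)
          ≈⟨ sum-remove (λ s → γ s * u s j) ⟩
        γ s₀ * u s₀ j + ∑[ k < n ] (γ (punchIn s₀ k) * u (punchIn s₀ k) j)
          ≈⟨ +-cong (*-congʳ (reflexive (insertAt-lookup β s₀ βμ)))
                    (sum-cong-≋ (λ k → *-congʳ (reflexive (insertAt-punchIn β s₀ βμ k)))) ⟩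
        βμ * u s₀ j + ∑[ k < n ] (β k * u (punchIn s₀ k) j)
          ≈⟨ +-comm _ _ ⟩
        ∑[ k < n ] (β k * u (punchIn s₀ k) j) + βμ * u s₀ j
          ≈⟨ +-congˡ (*-distribʳ-sum (u s₀ j) (λ k → β k * μ k)) ⟩
        ∑[ k < n ] (β k * u (punchIn s₀ k) j) + ∑[ k < n ] (β k * μ k * u s₀ j)
          ≈⟨ ∑-distrib-+ (λ k → β k * u (punchIn s₀ k) j) (λ k → β k * μ k * u s₀ j) ⟨
        ∑[ k < n ] (β k * u (punchIn s₀ k) j + β k * μ k * u s₀ j)
          ≈⟨ sum-cong-≋ (λ k → trans (+-congˡ (*-assoc (β k) (μ k) (u s₀ j))) (sym (distribˡ (β k) _ _))) ⟩
        ∑[ k < n ] (β k * u′ k j)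
          ≈⟨ β-rel j ⟩
        0# ∎

  independent-≤-spanning : ∀ {J : Set} {n e} {u : Fin n → J → K} {w : Fin e → J → K} →
    Independent u → u ⊆⟨ w ⟩ → ¬ ¬ (n ℕ.≤ e)
  independent-≤-spanning {n = zero} _ _ = return ℕ.z≤n
  independent-≤-spanning {n = suc n} {zero} u-indep u⊆w _ =
    1≉0 (u-indep (λ _ → 1#) (λ j → sum-zero (λ s → trans (*-identityˡ _) (expand (u⊆w s) j))) zero)
  independent-≤-spanning {n = suc n} {suc e} {w = w} u-indep u⊆w = do
    zero? ← ¬¬-∀-Fin {P = λ s → Dec (coeff (u⊆w s) zero ≈ 0#)} (λ s → ¬¬-excluded-middle)
    case Fin.any? (λ s → ¬? (zero? s)) of λ where
      (yes (s₀ , a₀≉0)) → do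
        let u′ , u′-indep , u′⊆w = exchange u-indep u⊆w s₀ a₀≉0
        n≤e ← independent-≤-spanning u′-indep u′⊆w
        return (s≤s n≤e)
      (no ∄a₀≉0) → do
        n≤e ← independent-≤-spanning u-indep λ s →
          ∈⟨⟩-tail {w = w} (u⊆w s) (decidable-stable (zero? s) (λ a₀≉0 → ∄a₀≉0 (s , a₀≉0)))
        return (ℕ.m≤n⇒m≤1+n n≤e)

  independent-≤-card : ∀ {J : Set} {D n} {u : Fin n → J → K} → Fin D ↔ J → Independent u → ¬ ¬ (n ℕ.≤ D)
  independent-≤-card {u = u} Fin↔J u-indep = independent-≤-spanning {w = δ} enumerated-indep enumerated⊆δ
    where
    open Inverse Fin↔J
    enumerated-indep : Independent (λ s k → u s (to k))
    enumerated-indep a rel = u-indep a λ j →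
      ≡.subst (λ j → ∑[ s < _ ] (a s * u s j) ≈ 0#) (strictlyInverseˡ j) (rel (from j))
    enumerated⊆δ : (λ s k → u s (to k)) ⊆⟨ δ ⟩
    enumerated⊆δ s = span (λ k → u s (to k)) λ k → sym (∑-δ (λ k → u s (to k)) k)

  -- Gaussian elimination

  Pivot : ∀ {N} → (Fin N → K) → Fin N → Set ℓ
  Pivot v p = ¬ v p ≈ 0# × (∀ q → q Fin.< p → v q ≈ 0#)

  pivot-unique : ∀ {N} {v : Fin N → K} {p q} → Pivot v p → Pivot v q → p ≡ q
  pivot-unique {p = p} {q} (vp≉0 , below-p) (vq≉0 , below-q) with Fin.<-cmp p q
  ... | tri< p<q _ _ = contradiction (below-q p p<q) vp≉0
  ... | tri≈ _ p≡q _ = p≡q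
  ... | tri> _ _ q<p = contradiction (below-p q q<p) vq≉0

  pivot-of : ∀ {N} {v : Fin N → K} → (∀ p → Dec (v p ≈ 0#)) → ¬ (∀ p → v p ≈ 0#) → ∃ (Pivot v)
  pivot-of {zero} _ v≉0 = contradiction (λ ()) v≉0
  pivot-of {suc N} v≈0? v≉0 with v≈0? zero
  ... | no v₀≉0 = zero , v₀≉0 , λ _ ()
  ... | yes v₀≈0 with pivot-of (v≈0? ∘ suc) (λ vₛ≈0 → v≉0 λ { zero → v₀≈0 ; (suc p) → vₛ≈0 p })
  ...   | p , vₚ≉0 , below = suc p , vₚ≉0 , λ { zero _ → v₀≈0 ; (suc q) (s≤s q<p) → below q q<p }

  ¬¬-pivot : ∀ {N} {v : Fin N → K} → ¬ (∀ p → v p ≈ 0#) → ¬ ¬ ∃ (Pivot v)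
  ¬¬-pivot {v = v} v≉0 = do
    v≈0? ← ¬¬-∀-Fin {P = λ p → Dec (v p ≈ 0#)} (λ _ → ¬¬-excluded-middle)
    return (pivot-of v≈0? v≉0)

  record Echelon {N e} (E : Fin e → Fin N → K) : Set ℓ where
    field
      pivot : Fin e → Fin N
      isPivot : ∀ s → Pivot (E s) (pivot s)
      pivot-injective : ∀ {s s′} → pivot s ≡ pivot s′ → s ≡ s′

  module _ {N e} {E : Fin e → Fin N → K} (ech : Echelon E) where
    open Echelon ech

    echelon-vanishing : (a : Fin e → K) → (∀ s → ∑[ s′ < e ] (a s′ * E s′ (pivot s)) ≈ 0#) → ∀ s → a s ≈ 0#
    echelon-vanishing a rel s = go s (Fin.<-wellFounded (pivot s))
      where
      go : ∀ s → Acc Fin._<_ (pivot s) → a s ≈ 0#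
      go s (acc below) = x*y≈0⇒x≈0 (trans (sym (sum-single _ s others)) (rel s)) (proj₁ (isPivot s))
        where
        others : ∀ s′ → s′ ≢ s → a s′ * E s′ (pivot s) ≈ 0#
        others s′ s′≢s with Fin.<-cmp (pivot s′) (pivot s)
        ... | tri< lt _ _ = trans (*-congʳ (go s′ (below lt))) (zeroˡ _)
        ... | tri≈ _ eq _ = contradiction (pivot-injective eq) s′≢s
        ... | tri> _ _ gt = trans (*-congˡ (proj₂ (isPivot s′) (pivot s) gt)) (zeroʳ _)

    echelon⇒independent : Independent E
    echelon⇒independent a rel = echelon-vanishing a (λ s → rel (pivot s))

  echelon-∷ : ∀ {N e} {E : Fin e → Fin N → K} {r p₀} (ech : Echelon E) → Pivot r p₀ →
    (∀ s → Echelon.pivot ech s ≢ p₀) → Echelon (r ∷ E)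
  echelon-∷ {E = E} {r} {p₀} ech r-piv fresh = record
    { pivot = p₀ ∷ pivot
    ; isPivot = λ { zero → r-piv ; (suc s) → isPivot s }
    ; pivot-injective = injective
    }
    where
    open Echelon ech
    injective : ∀ {s s′} → (p₀ ∷ pivot) s ≡ (p₀ ∷ pivot) s′ → s ≡ s′
    injective {zero} {zero} _ = ≡.refl
    injective {zero} {suc s′} eq = contradiction (≡.sym eq) (fresh s′)
    injective {suc s} {zero} eq = contradiction eq (fresh s)
    injective {suc s} {suc s′} eq = ≡.cong suc (pivot-injective eq)

  module Reduction {N e} {E : Fin e → Fin N → K} (ech : Echelon E) where
    open Echelon ech

    record Reduct (g : Fin N → K) : Set (c ⊔ˡ ℓ) where
      field
        residue : Fin N → K
        offset : Fin N → K
        offset∈⟨E⟩ : offset ∈⟨ E ⟩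
        residue≈ : ∀ p → residue p ≈ g p + offset p
        reduced : (∀ p → residue p ≈ 0#) ⊎ ∃ λ p → Pivot residue p × (∀ s → pivot s ≢ p)

    -- Clearing the pivot of h with the basis vector having the same pivot moves the pivot
    -- strictly to the right, which makes the recursion well founded.
    reduce-from : ∀ g p → Acc Fin._>_ p → (h v : Fin N → K) → v ∈⟨ E ⟩ →
      (∀ q → h q ≈ g q + v q) → Pivot h p → ¬ ¬ Reduct g
    reduce-from g p (acc above) h v v∈ h≈ h-piv with Fin.any? (λ s → pivot s Fin.≟ p)
    ... | no p-fresh = return record
      { residue = h ; offset = v ; offset∈⟨E⟩ = v∈ ; residue≈ = h≈
      ; reduced = inj₂ (p , h-piv , λ s eq → p-fresh (s , eq)) }
    ... | yes (s , ≡.refl) = ¬¬-excluded-middle >>= next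
      where
      μ : K
      μ = - (h (pivot s) * proj₁ (inverse (E s (pivot s)) (proj₁ (isPivot s))))

      h′ v′ : Fin N → K
      h′ q = h q + μ * E s q
      v′ q = v q + μ * E s q

      v′∈ : v′ ∈⟨ E ⟩
      v′∈ = ∈⟨⟩-+ v∈ (∈⟨⟩-* μ (∈⟨⟩-member E s))

      h′≈ : ∀ q → h′ q ≈ g q + v′ q
      h′≈ q = trans (+-congʳ (h≈ q)) (+-assoc _ _ _)

      pivot-advances : ∀ {p′} → Pivot h′ p′ → pivot s Fin.< p′
      pivot-advances {p′} (h′p′≉0 , _) with Fin.<-cmp (pivot s) p′
      ... | tri< lt _ _ = lt
      ... | tri≈ _ ≡.refl _ =
        contradiction (x+-[x*y]*z≈0 (h (pivot s)) (proj₂ (inverse _ (proj₁ (isPivot s))))) h′p′≉0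
      ... | tri> _ _ gt = contradiction
        (trans (+-cong (proj₂ h-piv p′ gt) (trans (*-congˡ (proj₂ (isPivot s) p′ gt)) (zeroʳ μ))) (+-identityˡ 0#))
        h′p′≉0

      next : Dec (∀ q → h′ q ≈ 0#) → ¬ ¬ Reduct g
      next (yes h′≈0) = return record
        { residue = h′ ; offset = v′ ; offset∈⟨E⟩ = v′∈ ; residue≈ = h′≈ ; reduced = inj₁ h′≈0 }
      next (no h′≉0) = do
        p′ , h′-piv ← ¬¬-pivot h′≉0
        reduce-from g p′ (above (pivot-advances h′-piv)) h′ v′ v′∈ h′≈ h′-piv

    reduce : ∀ g → ¬ ¬ Reduct g
    reduce g = ¬¬-excluded-middle >>= first
      where
      g≈g+0 : ∀ p → g p ≈ g p + 0#
      g≈g+0 p = sym (+-identityʳ (g p))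

      first : Dec (∀ p → g p ≈ 0#) → ¬ ¬ Reduct g
      first (yes g≈0) = return record
        { residue = g ; offset = λ _ → 0# ; offset∈⟨E⟩ = ∈⟨⟩-0 ; residue≈ = g≈g+0 ; reduced = inj₁ g≈0 }
      first (no g≉0) = do
        p , g-piv ← ¬¬-pivot g≉0
        reduce-from g p (Fin.>-wellFounded p) g (λ _ → 0#) ∈⟨⟩-0 g≈g+0 g-piv

  record EchelonBasis {N d} (g : Fin d → Fin N → K) : Set (c ⊔ˡ ℓ) where
    field
      rank : ℕ
      select : Fin rank → Fin d
      selected-independent : Independent (g ∘ select)
      basis : Fin rank → Fin N → K
      echelon : Echelon basis
      g⊆basis : g ⊆⟨ basis ⟩
      basis⊆selected : basis ⊆⟨ g ∘ select ⟩

  module Extension {N d} (g : Fin (suc d) → Fin N → K) (B : EchelonBasis (g ∘ suc))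
    (R : Reduction.Reduct (EchelonBasis.echelon B) (g zero)) where
    open EchelonBasis B
    open Reduction.Reduct R

    g₀≈ : ∀ p → g zero p ≈ 1# * residue p + - 1# * offset p
    g₀≈ p = sym (begin
      1# * residue p + - 1# * offset p  ≈⟨ +-cong (*-identityˡ _) (-1*x≈-x _) ⟩
      residue p + - offset p            ≈⟨ +-congʳ (residue≈ p) ⟩
      g zero p + offset p + - offset p  ≈⟨ +-assoc _ _ _ ⟩
      g zero p + (offset p + - offset p) ≈⟨ +-congˡ (-‿inverseʳ _) ⟩
      g zero p + 0#                     ≈⟨ +-identityʳ _ ⟩
      g zero p                          ∎)

    extend : EchelonBasis g
    extend with reduced
    ... | inj₁ residue≈0 = record
      { rank = rank
      ; select = suc ∘ select
      ; selected-independent = selected-independent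
      ; basis = basis
      ; echelon = echelon
      ; g⊆basis = λ { zero → g₀∈ ; (suc t) → g⊆basis t }
      ; basis⊆selected = basis⊆selected
      }
      where
      g₀∈ : g zero ∈⟨ basis ⟩
      g₀∈ = ∈⟨⟩-cong (λ p → sym (trans (g₀≈ p) (trans (+-congʳ (trans (*-congˡ (residue≈0 p)) (zeroʳ 1#)))
                                                         (+-identityˡ _))))
                     (∈⟨⟩-* (- 1#) offset∈⟨E⟩)
    ... | inj₂ (p₀ , residue-pivot , fresh) = record
      { rank = suc rank
      ; select = select′
      ; selected-independent = independent′
      ; basis = residue ∷ basis
      ; echelon = echelon′
      ; g⊆basis = λ { zero → g₀∈ ; (suc t) → ∈⟨⟩-weaken {w = residue ∷ basis} (g⊆basis t) }
      ; basis⊆selected = λ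
        { zero → ∈⟨⟩-cong (λ p → trans (+-congʳ (*-identityˡ _)) (sym (residue≈ p)))
                          (∈⟨⟩-∷ {w = g ∘ select′} 1# (∈⟨⟩-trans offset∈⟨E⟩ basis⊆selected))
        ; (suc s) → ∈⟨⟩-weaken {w = g ∘ select′} (basis⊆selected s) }
      }
      where
      select′ : Fin (suc rank) → Fin (suc d)
      select′ = zero ∷ suc ∘ select

      echelon′ : Echelon (residue ∷ basis)
      echelon′ = echelon-∷ echelon residue-pivot fresh

      g₀∈ : g zero ∈⟨ residue ∷ basis ⟩
      g₀∈ = ∈⟨⟩-cong (λ p → sym (g₀≈ p)) (∈⟨⟩-∷ {w = residue ∷ basis} 1# (∈⟨⟩-* (- 1#) offset∈⟨E⟩))

      independent′ : Independent (g ∘ select′)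
      independent′ a rel = λ { zero → a₀≈0 ; (suc s) → selected-independent (a ∘ suc) rest s }
        where
        combination : (λ p → a zero * g zero p + ∑[ s < rank ] (a (suc s) * g (suc (select s)) p))
                        ∈⟨ residue ∷ basis ⟩
        combination = ∈⟨⟩-+ (∈⟨⟩-* (a zero) g₀∈)
                            (∈⟨⟩-weaken {w = residue ∷ basis} (∈⟨⟩-∑ (a ∘ suc) (g⊆basis ∘ select)))

        a₀≈0 : a zero ≈ 0#
        a₀≈0 = trans (sym (trans (+-identityʳ _) (*-identityʳ (a zero))))
          (echelon⇒independent echelon′ (coeff combination) (λ p → trans (sym (expand combination p)) (rel p)) zero)

        rest : ∀ p → ∑[ s < rank ] (a (suc s) * g (suc (select s)) p) ≈ 0#
        rest p = trans (sym (trans (+-congʳ (trans (*-congʳ a₀≈0) (zeroˡ _))) (+-identityˡ _))) (rel p)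

  ¬¬-echelonBasis : ∀ {N} d (g : Fin d → Fin N → K) → ¬ ¬ EchelonBasis g
  ¬¬-echelonBasis zero g = return record
    { rank = 0 ; select = λ () ; selected-independent = λ _ _ () ; basis = λ ()
    ; echelon = record { pivot = λ () ; isPivot = λ () ; pivot-injective = λ { {()} } }
    ; g⊆basis = λ () ; basis⊆selected = λ () }
  ¬¬-echelonBasis (suc d) g = do
    B ← ¬¬-echelonBasis d (g ∘ suc)
    R ← Reduction.reduce (EchelonBasis.echelon B) (g zero)
    return (Extension.extend g B R)

  -- Rank

  module _ {J : Set} where

    pad : ∀ l {e} → (Fin e → J → K) → Fin (l ℕ.+ e) → J → K
    pad zero w = w
    pad (suc l) w = (λ _ → 0#) ∷ pad l w

    ∈⟨⟩-pad : ∀ l {e} {w : Fin e → J → K} {v : J → K} → v ∈⟨ w ⟩ → v ∈⟨ pad l w ⟩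
    ∈⟨⟩-pad zero v∈ = v∈
    ∈⟨⟩-pad (suc l) {w = w} v∈ = ∈⟨⟩-weaken {w = pad (suc l) w} (∈⟨⟩-pad l v∈)

    ⊆⟨⟩-pad : ∀ {n e q} {u : Fin n → J → K} {w : Fin e → J → K} → e ℕ.≤ q → u ⊆⟨ w ⟩ →
      Σ (Fin q → J → K) λ w′ → u ⊆⟨ w′ ⟩
    ⊆⟨⟩-pad {e = e} {q} {u} {w} e≤q u⊆w = ≡.subst (λ q → Σ (Fin q → J → K) (u ⊆⟨_⟩)) (ℕ.m∸n+n≡m e≤q)
      (pad (q ℕ.∸ e) w , λ s → ∈⟨⟩-pad (q ℕ.∸ e) (u⊆w s))

  module _ {m : ℕ} {J : Set} {A : Mat m J} where

    Independent⇒LinIndepCols : ∀ {r} {σ : Fin r → J} → Independent (λ s a → A a (σ s)) → LinIndepCols A σ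
    Independent⇒LinIndepCols {σ = σ} indep a rel =
      indep a (λ row → trans (sym (sumF≈sum (λ s → a s * A row (σ s)))) (rel row))

    LinIndepCols⇒Independent : ∀ {r} {σ : Fin r → J} → LinIndepCols A σ → Independent (λ s a → A a (σ s))
    LinIndepCols⇒Independent {σ = σ} indep a rel =
      indep a (λ row → trans (sumF≈sum (λ s → a s * A row (σ s))) (rel row))

    RankGE-tail : ∀ {n} → RankGE A (suc n) → RankGE A n
    RankGE-tail (σ , σ-indep) = σ ∘ suc , λ a rel s →
      σ-indep (0# ∷ a) (λ row → trans (+-congʳ (zeroˡ _)) (trans (+-identityˡ _) (rel row))) (suc s)

    RankGE-≤ : ∀ {k n} → k ℕ.≤ n → RankGE A n → RankGE A k
    RankGE-≤ k≤n rk with ℕ.m≤n⇒m<n∨m≡n k≤n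
    ... | inj₂ ≡.refl = rk
    ... | inj₁ (s≤s k≤n-1) = RankGE-≤ k≤n-1 (RankGE-tail rk)

    RankGE-bounded : ∀ {ρ q} → RankGE A ρ → ¬ RankGE A (suc q) → ρ ℕ.≤ q
    RankGE-bounded {ρ} {q} rk ¬rk with ρ ℕ.≤? q
    ... | yes ρ≤q = ρ≤q
    ... | no ρ≰q = contradiction (RankGE-≤ (ℕ.≰⇒> ρ≰q) rk) ¬rk

  module _ {m n : ℕ} (A : Mat m (Fin n)) where

    columns : Fin n → Fin m → K
    columns t a = A a t

    columns-basis-rank : (B : EchelonBasis columns) → RankGE A (EchelonBasis.rank B)
    columns-basis-rank B = select , Independent⇒LinIndepCols {A = A} selected-independent
      where open EchelonBasis B

    -- Row rank ≤ column rank: transpose the expansions of the columns through the selected ones.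
    rows⊆ : (B : EchelonBasis columns) → Σ (Fin (EchelonBasis.rank B) → Fin n → K) (A ⊆⟨_⟩)
    rows⊆ B = W , λ a → span (λ r → A a (select r)) λ t →
      trans (expand (column∈ t) a) (sum-cong-≋ (λ r → *-comm (coeff (column∈ t) r) (A a (select r))))
      where
      open EchelonBasis B
      column∈ : ∀ t → columns t ∈⟨ columns ∘ select ⟩
      column∈ t = ∈⟨⟩-trans (g⊆basis t) basis⊆selected
      W : Fin rank → Fin n → K
      W r t = coeff (column∈ t) r

    columns-spanned : ∀ {q} → ¬ RankGE A (suc q) → ¬ ¬ Σ (Fin q → Fin m → K) (columns ⊆⟨_⟩)
    columns-spanned ¬rk = do
      B ← ¬¬-echelonBasis n columns
      return (⊆⟨⟩-pad (RankGE-bounded {A = A} (columns-basis-rank B) ¬rk) (EchelonBasis.g⊆basis B))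

    rows-spanned : ∀ {q} → ¬ RankGE A (suc q) → ¬ ¬ Σ (Fin q → Fin n → K) (A ⊆⟨_⟩)
    rows-spanned ¬rk = do
      B ← ¬¬-echelonBasis n columns
      return (⊆⟨⟩-pad (RankGE-bounded {A = A} (columns-basis-rank B) ¬rk) (proj₂ (rows⊆ B)))

  RankGE-≤-row-span : ∀ {m n e} {J : Set} {M : Mat m J} {E : Fin e → J → K} →
    RankGE M n → M ⊆⟨ E ⟩ → ¬ ¬ (n ℕ.≤ e)
  RankGE-≤-row-span {M = M} {E} (σ , σ-indep) M⊆E =
    independent-≤-spanning (LinIndepCols⇒Independent {A = M} σ-indep) column∈
    where
    column∈ : (λ x t → M t (σ x)) ⊆⟨ (λ s t → coeff (M⊆E t) s) ⟩
    column∈ x = span (λ s → E s (σ x)) λ t →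
      trans (expand (M⊆E t) (σ x)) (sum-cong-≋ (λ s → *-comm (coeff (M⊆E t) s) (E s (σ x))))

  -- Matrices, tensors and pivot covers

  module Flattening {p q : ℕ} where

    flatten : Mat p (Fin q) → Fin (p ℕ.* q) → K
    flatten A k = uncurry A (Fin.remQuot {p} q k)

    unflatten : (Fin (p ℕ.* q) → K) → Mat p (Fin q)
    unflatten v a b = v (Fin.combine a b)

    flatten-combine : ∀ (A : Mat p (Fin q)) a b → flatten A (Fin.combine a b) ≡ A a b
    flatten-combine A a b = ≡.cong (uncurry A) (Fin.remQuot-combine a b)

    combine-<lex : ∀ {a a′ : Fin p} {b b′ : Fin q} → (a′ , b′) <lex (a , b) →
      Fin.combine a′ b′ Fin.< Fin.combine a b
    combine-<lex (inj₁ a′<a) = Fin.combine-monoˡ-< _ _ a′<a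
    combine-<lex {a} {b = b} {b′} (inj₂ (≡.refl , b′<b)) =
      ≡.subst₂ ℕ._<_ (≡.sym (Fin.toℕ-combine a b′)) (≡.sym (Fin.toℕ-combine a b))
        (ℕ.+-monoʳ-< (q ℕ.* Fin.toℕ a) b′<b)

    combine-<⇒<lex : ∀ {a a′ : Fin p} {b b′ : Fin q} → Fin.combine a′ b′ Fin.< Fin.combine a b →
      (a′ , b′) <lex (a , b)
    combine-<⇒<lex {a} {a′} {b} {b′} lt with Fin.<-cmp a′ a
    ... | tri< a′<a _ _ = inj₁ a′<a
    ... | tri> _ _ a<a′ = contradiction (Fin.combine-monoˡ-< b b′ a<a′) (Fin.<-asym lt)
    ... | tri≈ _ ≡.refl _ with Fin.<-cmp b′ b
    ...   | tri< b′<b _ _ = inj₂ (≡.refl , b′<b)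
    ...   | tri≈ _ ≡.refl _ = contradiction lt (Fin.<-irrefl ≡.refl)
    ...   | tri> _ _ b<b′ = contradiction (combine-<lex (inj₂ (≡.refl , b<b′))) (Fin.<-asym lt)

    Pivot⇒IsPivot : ∀ {v a b} → Pivot v (Fin.combine a b) → IsPivot (unflatten v) (a , b)
    Pivot⇒IsPivot (v≉0 , below) = v≉0 , λ a′ b′ lt → below _ (combine-<lex lt)

    IsPivot⇒Pivot : ∀ {v a b} → IsPivot (unflatten v) (a , b) → Pivot v (Fin.combine a b)
    IsPivot⇒Pivot {v} {a} {b} (v≉0 , below) = v≉0 , λ k k<ab →
      let ab′ = Fin.remQuot {p} q k
          k≡ = Fin.combine-remQuot {p} q k
      in ≡.subst (λ k → v k ≈ 0#) k≡
           (below (proj₁ ab′) (proj₂ ab′) (combine-<⇒<lex (≡.subst (Fin._< Fin.combine a b) (≡.sym k≡) k<ab)))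

    Pivot⇒IsPivot-remQuot : ∀ {v k} → Pivot v k → IsPivot (unflatten v) (Fin.remQuot {p} q k)
    Pivot⇒IsPivot-remQuot {v} {k} piv = Pivot⇒IsPivot (≡.subst (Pivot v) (≡.sym (Fin.combine-remQuot {p} q k)) piv)

    InSpan-unflatten : ∀ {d} {gens : Fin d → Mat p (Fin q)} {A : Mat p (Fin q)} {w v} →
      (∀ t a b → gens t a b ≈ unflatten (w t) a b) → (∀ a b → A a b ≈ unflatten v a b) →
      v ∈⟨ w ⟩ → InSpan gens A
    InSpan-unflatten {gens = gens} {w = w} gens≈ A≈ (span coef v≈) = coef , λ a b →
      trans (A≈ a b) (trans (v≈ (Fin.combine a b)) (sym (trans (sumF≈sum (λ t → coef t * gens t a b))
        (sum-cong-≋ (λ t → *-congˡ (gens≈ t a b))))))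

    LinIndepFam-unflatten : ∀ {e} {E : Fin e → Fin (p ℕ.* q) → K} → Independent E → LinIndepFam (unflatten ∘ E)
    LinIndepFam-unflatten {E = E} indep coef rel = indep coef λ k →
      let a , b = Fin.remQuot {p} q k in
      ≡.subst (λ k → ∑[ s < _ ] (coef s * E s k) ≈ 0#) (Fin.combine-remQuot {p} q k)
        (trans (sym (sumF≈sum (λ s → coef s * E s (Fin.combine a b)))) (rel a b))

  module SliceBound {p q d : ℕ} (gens : Fin d → Mat p (Fin q)) where
    open Flattening {p} {q}

    G : Fin d → Fin (p ℕ.* q) → K
    G t = flatten (gens t)

    module _ (B : EchelonBasis G) where
      open EchelonBasis B
      open Echelon echelon

      basis-matrices : IsBasisOfSpan gens (unflatten ∘ basis)
      basis-matrices =
          (λ s → InSpan-unflatten (λ t a b → sym (reflexive (flatten-combine (gens t) a b))) (λ _ _ → refl)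
                                  (∈⟨⟩-∘ {w = G} select (basis⊆selected s)))
        , LinIndepFam-unflatten (echelon⇒independent echelon)
        , (λ t → InSpan-unflatten (λ _ _ _ → refl) (λ a b → sym (reflexive (flatten-combine (gens t) a b)))
                                  (g⊆basis t))

      distinct-pivots : DistinctPivots (unflatten ∘ basis)
      distinct-pivots s s′ _ piv piv′ = pivot-injective
        (≡.trans (pivot-unique (isPivot s) (IsPivot⇒Pivot piv)) (≡.sym (pivot-unique (isPivot s′) (IsPivot⇒Pivot piv′))))

      pivots-covered : ∀ {S₁ S₂} → Covers gens S₁ S₂ → ∀ s →
        proj₁ (Fin.remQuot {p} q (pivot s)) ∈ S₁ ⊎ proj₂ (Fin.remQuot {p} q (pivot s)) ∈ S₂
      pivots-covered covers s = covers _ _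
        (rank , unflatten ∘ basis , basis-matrices , distinct-pivots , s , Pivot⇒IsPivot-remQuot (isPivot s))

      rank-≥ : RankGE (λ t pos → gens t (proj₁ pos) (proj₂ pos)) d → ¬ ¬ (d ℕ.≤ rank)
      rank-≥ rk = RankGE-≤-row-span rk λ t →
        ∈⟨⟩-cong (λ pos → reflexive (flatten-combine (gens t) (proj₁ pos) (proj₂ pos)))
                 (∈⟨⟩-reindex (uncurry Fin.combine) (g⊆basis t))

      rank-≤ : ∀ {qi qj S₁ S₂} → Covers gens S₁ S₂ →
        (rows : ∀ a → Σ (Fin qi → Fin q → K) λ R → (λ t → gens t a) ⊆⟨ R ⟩) →
        (cols : ∀ b → Σ (Fin qj → Fin p → K) λ C → (λ t a → gens t a b) ⊆⟨ C ⟩) →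
        ¬ ¬ (rank ℕ.≤ ∣ S₁ ∣ ℕ.* qi ℕ.+ ∣ S₂ ∣ ℕ.* qj)
      rank-≤ {qi} {qj} {S₁} {S₂} covers rows cols = independent-≤-card enumeration κ-independent
        where
        row∈ : ∀ s a → (λ b → basis s (Fin.combine a b)) ∈⟨ proj₁ (rows a) ⟩
        row∈ s a = ∈⟨⟩-trans (∈⟨⟩-reindex (Fin.combine a) (basis⊆selected s))
          (λ t → ∈⟨⟩-cong (λ b → sym (reflexive (flatten-combine (gens (select t)) a b))) (proj₂ (rows a) (select t)))

        col∈ : ∀ s b → (λ a → basis s (Fin.combine a b)) ∈⟨ proj₁ (cols b) ⟩
        col∈ s b = ∈⟨⟩-trans (∈⟨⟩-reindex (λ a → Fin.combine a b) (basis⊆selected s))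
          (λ t → ∈⟨⟩-cong (λ a → sym (reflexive (flatten-combine (gens (select t)) a b))) (proj₂ (cols b) (select t)))

        Coordinate : Set
        Coordinate = (Fin ∣ S₁ ∣ × Fin qi) ⊎ (Fin ∣ S₂ ∣ × Fin qj)

        enumeration : Fin (∣ S₁ ∣ ℕ.* qi ℕ.+ ∣ S₂ ∣ ℕ.* qj) ↔ Coordinate
        enumeration = (Fin.*↔× ⊎-↔ Fin.*↔×) ↔-∘ Fin.+↔⊎

        -- Every pivot lies on a covered line, so a relation among the κ s is a relation
        -- among the basis matrices at all pivots.
        κ : Fin rank → Coordinate → K
        κ s (inj₁ (i , t)) = coeff (row∈ s (enumerate S₁ i)) t
        κ s (inj₂ (i , t)) = coeff (col∈ s (enumerate S₂ i)) t

        κ-independent : Independent κ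
        κ-independent a rel = echelon-vanishing echelon a vanishes-at-pivot
          where
          Vanishes : Fin (p ℕ.* q) → Set ℓ
          Vanishes k = ∑[ s < rank ] (a s * basis s k) ≈ 0#

          vanishes-at-pivot : ∀ s → Vanishes (pivot s)
          vanishes-at-pivot s = [ through-row , through-column ]′ (pivots-covered covers s)
            where
            a₀ = proj₁ (Fin.remQuot {p} q (pivot s))
            b₀ = proj₂ (Fin.remQuot {p} q (pivot s))

            at-pivot : Fin.combine a₀ b₀ ≡ pivot s
            at-pivot = Fin.combine-remQuot {p} q (pivot s)

            through-row : a₀ ∈ S₁ → Vanishes (pivot s)
            through-row a₀∈S₁ = let i , i↦a₀ = enumerate-onto S₁ a₀∈S₁ in
              ≡.subst Vanishes (≡.trans (≡.cong (λ a → Fin.combine a b₀) i↦a₀) at-pivot)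
                (relation-from-coordinates (λ s → row∈ s (enumerate S₁ i)) a (λ t → rel (inj₁ (i , t))) b₀)

            through-column : b₀ ∈ S₂ → Vanishes (pivot s)
            through-column b₀∈S₂ = let i , i↦b₀ = enumerate-onto S₂ b₀∈S₂ in
              ≡.subst Vanishes (≡.trans (≡.cong (Fin.combine a₀) i↦b₀) at-pivot)
                (relation-from-coordinates (λ s → col∈ s (enumerate S₂ i)) a (λ t → rel (inj₂ (i , t))) a₀)

    slice-count-bound : ∀ {qi qj r} →
      RankGE (λ t pos → gens t (proj₁ pos) (proj₂ pos)) d →
      (∀ a → ¬ ¬ Σ (Fin qi → Fin q → K) λ R → (λ t → gens t a) ⊆⟨ R ⟩) →
      (∀ b → ¬ ¬ Σ (Fin qj → Fin p → K) λ C → (λ t a → gens t a b) ⊆⟨ C ⟩) →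
      IsRhoSpan gens r → ¬ ¬ (d ℕ.≤ r ℕ.* (qi ℕ.⊔ qj))
    slice-count-bound {qi} {qj} {r} rk ¬¬rows ¬¬cols ((S₁ , S₂ , covers , size) , _) = do
      B ← ¬¬-echelonBasis d G
      rows ← ¬¬-∀-Fin ¬¬rows
      cols ← ¬¬-∀-Fin ¬¬cols
      d≤rank ← rank-≥ B rk
      rank≤ ← rank-≤ B covers rows cols
      return (ℕ.≤-trans d≤rank (ℕ.≤-trans rank≤ (weighted-sum-≤ {∣ S₁ ∣} {∣ S₂ ∣} {r} {qi} {qj} size)))

  IsMaxRankSpan⇒¬RankGE : ∀ {d m n} {gens : Fin d → Mat m (Fin n)} {q} → IsMaxRankSpan gens q →
    ∀ t → ¬ RankGE (gens t) (suc q)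
  IsMaxRankSpan⇒¬RankGE {gens = gens} (_ , bounded) t = bounded (gens t) (coeff t∈ , λ a b →
    trans (expand t∈ (a , b)) (sym (sumF≈sum (λ s → coeff t∈ s * gens s a b))))
    where
    t∈ = ∈⟨⟩-member (λ s pos → gens s (proj₁ pos) (proj₂ pos)) t

  RankGE-swap : ∀ {m n} {A B : Set} {M : Mat m (A × B)} → RankGE M n → RankGE (λ t pos → M t (swap pos)) n
  RankGE-swap (σ , σ-indep) = swap ∘ σ , σ-indep

  module Tensor {n₁ n₂ n₃ : ℕ} (T : Fin n₁ → Fin n₂ → Fin n₃ → K) where
    open TensorDefs T
    open SliceBound using (slice-count-bound)

    slice₁ : Fin n₁ → Mat n₂ (Fin n₃)
    slice₁ a b c = T a b c

    slice₂ : Fin n₂ → Mat n₁ (Fin n₃)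
    slice₂ b a c = T a b c

    slice₃ : Fin n₃ → Mat n₁ (Fin n₂)
    slice₃ c a b = T a b c

    flattening₁ : Mat n₁ (Fin n₂ × Fin n₃)
    flattening₁ a (b , c) = T a b c

    flattening₂ : Mat n₂ (Fin n₁ × Fin n₃)
    flattening₂ b (a , c) = T a b c

    flattening₃ : Mat n₃ (Fin n₁ × Fin n₂)
    flattening₃ c (a , b) = T a b c

    -- Depending on the order of j and k, the lines of a slice needed here are its columns or its rows.
    dim-bound : Concise → (i j k : Fin 3) → i ≢ j → j ≢ k → i ≢ k → ∀ {r qi qj} →
      IsRho i j k r → IsQ i qi → IsQ j qj → ¬ ¬ (dim k ℕ.≤ r ℕ.* (qi ℕ.⊔ qj))
    dim-bound ((rk₁ , _) , (rk₂ , _) , (rk₃ , _)) = λ where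
      0F 1F 2F _ _ _ ρ Qi Qj → slice-count-bound _ rk₃
        (λ a → columns-spanned (slice₁ a) (IsMaxRankSpan⇒¬RankGE Qi a))
        (λ b → columns-spanned (slice₂ b) (IsMaxRankSpan⇒¬RankGE Qj b)) ρ
      1F 0F 2F _ _ _ ρ Qi Qj → slice-count-bound _ (RankGE-swap {M = flattening₃} rk₃)
        (λ a → columns-spanned (slice₂ a) (IsMaxRankSpan⇒¬RankGE Qi a))
        (λ b → columns-spanned (slice₁ b) (IsMaxRankSpan⇒¬RankGE Qj b)) ρ
      0F 2F 1F _ _ _ ρ Qi Qj → slice-count-bound _ rk₂
        (λ a → rows-spanned (slice₁ a) (IsMaxRankSpan⇒¬RankGE Qi a))
        (λ b → columns-spanned (slice₃ b) (IsMaxRankSpan⇒¬RankGE Qj b)) ρ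
      2F 0F 1F _ _ _ ρ Qi Qj → slice-count-bound _ (RankGE-swap {M = flattening₂} rk₂)
        (λ a → columns-spanned (slice₃ a) (IsMaxRankSpan⇒¬RankGE Qi a))
        (λ b → rows-spanned (slice₁ b) (IsMaxRankSpan⇒¬RankGE Qj b)) ρ
      1F 2F 0F _ _ _ ρ Qi Qj → slice-count-bound _ rk₁
        (λ a → rows-spanned (slice₂ a) (IsMaxRankSpan⇒¬RankGE Qi a))
        (λ b → rows-spanned (slice₃ b) (IsMaxRankSpan⇒¬RankGE Qj b)) ρ
      2F 1F 0F _ _ _ ρ Qi Qj → slice-count-bound _ (RankGE-swap {M = flattening₁} rk₁)
        (λ a → rows-spanned (slice₃ a) (IsMaxRankSpan⇒¬RankGE Qi a))
        (λ b → rows-spanned (slice₂ b) (IsMaxRankSpan⇒¬RankGE Qj b)) ρ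
      0F 0F _ i≢j _ _ → contradiction ≡.refl i≢j
      1F 1F _ i≢j _ _ → contradiction ≡.refl i≢j
      2F 2F _ i≢j _ _ → contradiction ≡.refl i≢j
      _ 0F 0F _ j≢k _ → contradiction ≡.refl j≢k
      _ 1F 1F _ j≢k _ → contradiction ≡.refl j≢k
      _ 2F 2F _ j≢k _ → contradiction ≡.refl j≢k
      0F _ 0F _ _ i≢k → contradiction ≡.refl i≢k
      1F _ 1F _ _ i≢k → contradiction ≡.refl i≢k
      2F _ 2F _ _ i≢k → contradiction ≡.refl i≢k

open import Data.Nat using (_≤_; _*_; _⊔_)

theorem5p10 : {c ℓ : Level} (F : Field c ℓ) (n₁ n₂ n₃ : ℕ)
    (T : Fin n₁ → Fin n₂ → Fin n₃ → Field.Carrier F) →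
    FieldDefs.TensorDefs.Concise F T →
    (i j k : Fin 3) → i ≢ j → j ≢ k → i ≢ k →
    (r qi qj : ℕ) →
    FieldDefs.TensorDefs.IsRho F T i j k r →
    FieldDefs.TensorDefs.IsQ F T i qi →
    FieldDefs.TensorDefs.IsQ F T j qj →
    FieldDefs.TensorDefs.dim F T k ≤ r * (qi ⊔ qj)
theorem5p10 F n₁ n₂ n₃ T concise i j k i≢j j≢k i≢k r qi qj ρ Qi Qj =
  decidable-stable (_ ℕ.≤? _) (Tensor.dim-bound F T concise i j k i≢j j≢k i≢k ρ Qi Qj)
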